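{- Suppose the simplicial complex $\Delta$ is quasi-harmonious with respect to the dimension-decreasing strong shelling order $\succ$ on $\mathcal{F}(\Delta)$. Then for every pair of facets $F_i\succ F_j$ there is a sequence of facets $F_i=G_0,G_1,\dots,G_t=F_j$ such that (a) $t=\operatorname{dis}(F_i,F_j)$; (b) $\dim G_0\ge\dim G_1\ge\cdots\ge\dim G_t$; (c) $\operatorname{dis}(G_h,G_{h+1})=1$ for each $0\le h\le t-1$.
   Context: A simplicial complex is a finite family of subsets of a vertex set closed under taking subsets; $\mathcal{F}(\Delta)$ is its set of facets, $\dim(A)=|A|-1$ (so $\dim\varnothing=-1$). A linear order $F_1,\dots,F_t$ of $\mathcal{F}(\Delta)$ ($F_i\succ F_j$ iff $i<j$) is a strong shelling order if for every $1\le i<j\le t$ there exists $k$ with $1\le k<j$ such that $|F_j\setminus F_k|=1$, $F_j\setminus F_k\subseteq F_j\setminus F_i$, and $F_k\setminus F_j\subseteq F_i$; it is dimension-decreasing if $\dim F_i\ge\dim F_j$ whenever $i<j$. For facets $F,G$, $\operatorname{dis}(F,G)=\min(\dim F,\dim G)-\dim(F\cap G)$. $\Delta$ is quasi-harmonious with respect to a dimension-decreasing strong shelling order $\succ$ if for each pair of facets $F_i\succ F_j$ there exists a facet $F_k\succ F_j$ with $|F_j\setminus F_k|=1$, $F_i\cap F_j\subseteq F_k\subseteq F_i\cup F_j$, and $\dim F_i\ge\dim F_k\ge\dim F_j$. -}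

module Defs where

open import Data.Nat using (ℕ; suc)
open import Data.Integer using (ℤ; +_; _-_; _≤_)
open import Data.Fin using (Fin; _<_; zero; fromℕ; inject₁) renaming (suc to fsuc)
open import Data.Fin.Subset using (Subset; _⊆_; _∩_; _∪_; _─_; ∣_∣)
open import Data.Product using (Σ; _×_; ∃)
open import Relation.Binary.PropositionalEquality using (_≡_)
open import Function.Definitions using (Injective)

record SimplicialComplex (n : ℕ) : Set₁ where
  field
    face   : Subset n → Set
    closed : ∀ {A B} → face B → A ⊆ B → face A
open SimplicialComplex public

IsFacet : ∀ {n} → SimplicialComplex n → Subset n → Set
IsFacet Δ A = face Δ A × (∀ {B} → face Δ B → A ⊆ B → B ≡ A)

dim : ∀ {n} → Subset n → ℤ
dim A = + ∣ A ∣ - + 1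

minℤ : ℤ → ℤ → ℤ
minℤ = Data.Integer._⊓_

dis : ∀ {n} → Subset n → Subset n → ℤ
dis F G = minℤ (dim F) (dim G) - dim (F ∩ G)

-- A linear order F₁,…,F_t of 𝓕(Δ): an injective enumeration F : Fin t → Subset n
-- whose image is exactly the set of facets.  F i ≻ F j  iff  i < j.
record FacetOrder {n : ℕ} (Δ : SimplicialComplex n) : Set₁ where
  field
    t       : ℕ
    F       : Fin t → Subset n
    inj     : Injective _≡_ _≡_ F
    isFacet : ∀ i → IsFacet Δ (F i)
    onto    : ∀ A → IsFacet Δ A → ∃ λ i → F i ≡ A
open FacetOrder public

IsStrongShelling : ∀ {n} {Δ : SimplicialComplex n} → FacetOrder Δ → Set
IsStrongShelling O =
  ∀ (i j : Fin (t O)) → i < j →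
    Σ (Fin (t O)) λ k → k < j
      × ∣ F O j ─ F O k ∣ ≡ 1
      × (F O j ─ F O k) ⊆ (F O j ─ F O i)
      × (F O k ─ F O j) ⊆ F O i

IsDimDecreasing : ∀ {n} {Δ : SimplicialComplex n} → FacetOrder Δ → Set
IsDimDecreasing O = ∀ (i j : Fin (t O)) → i < j → dim (F O j) ≤ dim (F O i)

IsQuasiHarmonious : ∀ {n} {Δ : SimplicialComplex n} → FacetOrder Δ → Set
IsQuasiHarmonious O =
  ∀ (i j : Fin (t O)) → i < j →
    Σ (Fin (t O)) λ k → k < j
      × ∣ F O j ─ F O k ∣ ≡ 1
      × (F O i ∩ F O j) ⊆ F O k
      × F O k ⊆ (F O i ∪ F O j)
      × dim (F O k) ≤ dim (F O i)
      × dim (F O j) ≤ dim (F O k)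

-- Under a dimension-decreasing order, dis(F,G) for F ≻ G is the number |G ∖ F| of vertices of G
-- missing from F.  Quasi-harmony supplies, for F_i ≻ F_j, a facet F_k ≻ F_j lying between them
-- (F_i ∩ F_j ⊆ F_k ⊆ F_i ∪ F_j) with |F_j ∖ F_k| = 1; then |F_j ∖ F_i| = |F_k ∖ F_i| + 1, so
-- F_k is one unit step from F_j and one unit closer to F_i.  Induction on the distance joins
-- F_i to F_k by a dimension-decreasing chain; when F_k ≻ F_i the dimensions of F_i and F_k
-- agree, so the chain from F_k to F_i can be reversed.
module Submission where

open import Defs
open import Data.Nat using (ℕ; suc; _+_)
open import Data.Nat.Properties using (+-suc; +-comm; suc-injective)
open import Data.Integer using (ℤ; +_; _-_; _≤_)
open import Data.Integer.Properties
  using (+-injective; pos-+; ⊓-comm; ⊓-idem; i≤j⇒i⊓j≡i; i≡j⇒i-j≡0; ≤-refl; ≤-trans)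
open import Data.Integer.Tactic.RingSolver using (solve-∀)
open import Data.Fin using (Fin; _<_; zero; fromℕ; inject₁) renaming (suc to fsuc)
open import Data.Fin.Properties using (<-cmp)
open import Data.Fin.Subset using (Subset; inside; outside; _⊆_; _∩_; _∪_; _─_; ∣_∣)
open import Data.Fin.Subset.Properties using (drop-∷-⊆; ∩-comm; ∩-idem)
open import Data.Vec using (_∷_; []; here)
open import Data.Product using (Σ; _×_; _,_; proj₁; proj₂)
open import Function using (_∘_)
open import Relation.Binary using (tri<; tri≈; tri>)
open import Relation.Binary.PropositionalEquality
open import Relation.Nullary using (contradiction)

∣q∣≡∣p∩q∣+∣q─p∣ : ∀ {n} (p q : Subset n) → ∣ q ∣ ≡ ∣ p ∩ q ∣ + ∣ q ─ p ∣
∣q∣≡∣p∩q∣+∣q─p∣ []            []            = refl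
∣q∣≡∣p∩q∣+∣q─p∣ (outside ∷ p) (outside ∷ q) = ∣q∣≡∣p∩q∣+∣q─p∣ p q
∣q∣≡∣p∩q∣+∣q─p∣ (outside ∷ p) (inside  ∷ q) =
  trans (cong suc (∣q∣≡∣p∩q∣+∣q─p∣ p q)) (sym (+-suc _ _))
∣q∣≡∣p∩q∣+∣q─p∣ (inside  ∷ p) (outside ∷ q) = ∣q∣≡∣p∩q∣+∣q─p∣ p q
∣q∣≡∣p∩q∣+∣q─p∣ (inside  ∷ p) (inside  ∷ q) = cong suc (∣q∣≡∣p∩q∣+∣q─p∣ p q)

p∩r⊆q⊆p∪r⇒∣r─p∣≡∣q─p∣+∣r─q∣ : ∀ {n} (p q r : Subset n) → p ∩ r ⊆ q → q ⊆ p ∪ r →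
                               ∣ r ─ p ∣ ≡ ∣ q ─ p ∣ + ∣ r ─ q ∣
p∩r⊆q⊆p∪r⇒∣r─p∣≡∣q─p∣+∣r─q∣ [] [] [] _ _ = refl
p∩r⊆q⊆p∪r⇒∣r─p∣≡∣q─p∣+∣r─q∣ (x ∷ p) (y ∷ q) (z ∷ r) p∩r⊆q q⊆p∪r = go x y z p∩r⊆q q⊆p∪r
  where
  ih : ∣ r ─ p ∣ ≡ ∣ q ─ p ∣ + ∣ r ─ q ∣
  ih = p∩r⊆q⊆p∪r⇒∣r─p∣≡∣q─p∣+∣r─q∣ p q r (drop-∷-⊆ p∩r⊆q) (drop-∷-⊆ q⊆p∪r)
  go : ∀ x y z → (x ∷ p) ∩ (z ∷ r) ⊆ y ∷ q → y ∷ q ⊆ (x ∷ p) ∪ (z ∷ r) →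
       ∣ (z ∷ r) ─ (x ∷ p) ∣ ≡ ∣ (y ∷ q) ─ (x ∷ p) ∣ + ∣ (z ∷ r) ─ (y ∷ q) ∣
  go outside outside outside _ _ = ih
  go outside outside inside  _ _ = trans (cong suc ih) (sym (+-suc _ _))
  go outside inside  outside _ k = contradiction (k here) λ ()
  go outside inside  inside  _ _ = cong suc ih
  go inside  outside outside _ _ = ih
  go inside  outside inside  h _ = contradiction (h here) λ ()
  go inside  inside  outside _ _ = ih
  go inside  inside  inside  _ _ = ih

dis-sym : ∀ {n} (A B : Subset n) → dis A B ≡ dis B A
dis-sym A B = cong₂ _-_ (⊓-comm (dim A) (dim B)) (cong dim (∩-comm A B))

dis-self : ∀ {n} (A : Subset n) → dis A A ≡ + 0
dis-self A = i≡j⇒i-j≡0 (trans (⊓-idem (dim A)) (cong dim (sym (∩-idem A))))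

dis≡∣─∣ : ∀ {n} (A B : Subset n) → dim B ≤ dim A → dis A B ≡ + ∣ B ─ A ∣
dis≡∣─∣ A B dimB≤dimA = begin
  dim A ⊓ dim B - dim (A ∩ B)                     ≡⟨ cong (_- dim (A ∩ B)) dimA⊓dimB≡dimB ⟩
  (+ ∣ B ∣ - + 1) - (+ ∣ A ∩ B ∣ - + 1)           ≡⟨ cong (λ m → (m - + 1) - dim (A ∩ B)) ∣B∣≡ ⟩
  (+ ∣ A ∩ B ∣ +ℤ + ∣ B ─ A ∣ - + 1) - (+ ∣ A ∩ B ∣ - + 1) ≡⟨ cancel (+ ∣ A ∩ B ∣) (+ ∣ B ─ A ∣) ⟩
  + ∣ B ─ A ∣                                     ∎
  where
  open ≡-Reasoning
  open Data.Integer using (_⊓_) renaming (_+_ to _+ℤ_)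
  dimA⊓dimB≡dimB : dim A ⊓ dim B ≡ dim B
  dimA⊓dimB≡dimB = trans (⊓-comm (dim A) (dim B)) (i≤j⇒i⊓j≡i dimB≤dimA)
  ∣B∣≡ : + ∣ B ∣ ≡ + ∣ A ∩ B ∣ +ℤ + ∣ B ─ A ∣
  ∣B∣≡ = trans (cong +_ (∣q∣≡∣p∩q∣+∣q─p∣ A B)) (pos-+ ∣ A ∩ B ∣ ∣ B ─ A ∣)
  cancel : ∀ (a c : ℤ) → (a +ℤ c - + 1) - (a - + 1) ≡ c
  cancel = solve-∀

dis-through : ∀ {n} {A B C : Subset n} → dim B ≤ dim A → A ∩ B ⊆ C → C ⊆ A ∪ B →
              ∣ B ─ C ∣ ≡ 1 → dis A B ≡ + suc ∣ C ─ A ∣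
dis-through {A = A} {B} {C} dimB≤dimA A∩B⊆C C⊆A∪B ∣B─C∣≡1 =
  trans (dis≡∣─∣ A B dimB≤dimA) (cong +_ ∣B─A∣≡)
  where
  open ≡-Reasoning
  ∣B─A∣≡ : ∣ B ─ A ∣ ≡ suc ∣ C ─ A ∣
  ∣B─A∣≡ = begin
    (∣ B ─ A ∣)              ≡⟨ p∩r⊆q⊆p∪r⇒∣r─p∣≡∣q─p∣+∣r─q∣ A C B A∩B⊆C C⊆A∪B ⟩
    (∣ C ─ A ∣ + ∣ B ─ C ∣)  ≡⟨ +-comm (∣ C ─ A ∣) (∣ B ─ C ∣) ⟩
    (∣ B ─ C ∣ + ∣ C ─ A ∣)  ≡⟨ cong (_+ ∣ C ─ A ∣) ∣B─C∣≡1 ⟩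
    suc ∣ C ─ A ∣            ∎

module DescendingChain {n} {I : Set} (F : I → Subset n) where

  UnitStep : I → I → Set
  UnitStep a b = dim (F b) ≤ dim (F a) × dis (F a) (F b) ≡ + 1

  data Chain : I → I → ℕ → Set where
    []  : ∀ {a} → Chain a a 0
    _∷_ : ∀ {a b c s} → UnitStep a b → Chain b c s → Chain a c (suc s)

  _∷ʳ_ : ∀ {a b c s} → Chain a b s → UnitStep b c → Chain a c (suc s)
  []       ∷ʳ e = e ∷ []
  (e′ ∷ p) ∷ʳ e = e′ ∷ (p ∷ʳ e)

  chain-dim-≤ : ∀ {a b s} → Chain a b s → dim (F b) ≤ dim (F a)
  chain-dim-≤ []             = ≤-refl
  chain-dim-≤ ((le , _) ∷ p) = ≤-trans (chain-dim-≤ p) le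

  -- The hypothesis forces every facet on the chain to have the same dimension.
  reverse : ∀ {a b s} → Chain a b s → dim (F a) ≤ dim (F b) → Chain b a s
  reverse []                                _             = []
  reverse {a} (_∷_ {b = b} (dimB≤dimA , disAB≡1) p) dimA≤dimEnd =
    reverse p (≤-trans dimB≤dimA dimA≤dimEnd)
      ∷ʳ (≤-trans dimA≤dimEnd (chain-dim-≤ p) , trans (dis-sym (F b) (F a)) disAB≡1)

  vertex : ∀ {a b s} → Chain a b s → Fin (suc s) → I
  vertex {a} []      _        = a
  vertex {a} (_ ∷ p) zero     = a
  vertex     (_ ∷ p) (fsuc h) = vertex p h

  vertex-first : ∀ {a b s} (p : Chain a b s) → vertex p zero ≡ a
  vertex-first []      = refl
  vertex-first (_ ∷ p) = refl

  vertex-last : ∀ {a b s} (p : Chain a b s) → vertex p (fromℕ s) ≡ b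
  vertex-last []      = refl
  vertex-last (_ ∷ p) = vertex-last p

  unitStep-at : ∀ {a b s} (p : Chain a b s) (h : Fin s) → UnitStep (vertex p (inject₁ h)) (vertex p (fsuc h))
  unitStep-at {a} (e ∷ p) zero     = subst (UnitStep a) (sym (vertex-first p)) e
  unitStep-at     (_ ∷ p) (fsuc h) = unitStep-at p h

module _ {n} {Δ : SimplicialComplex n} (O : FacetOrder Δ)
         (dimDecreasing : IsDimDecreasing O) (quasiHarmonious : IsQuasiHarmonious O) where

  open DescendingChain (F O)

  mutual
    chain : ∀ d i j → i < j → dis (F O i) (F O j) ≡ + d → Chain i j d
    chain d i j i<j dis≡d with quasiHarmonious i j i<j
    ... | k , _ , ∣Fj─Fk∣≡1 , Fi∩Fj⊆Fk , Fk⊆Fi∪Fj , dimFk≤dimFi , dimFj≤dimFk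
      with d | +-injective (trans (sym dis≡d)
                 (dis-through (dimDecreasing i j i<j) Fi∩Fj⊆Fk Fk⊆Fi∪Fj ∣Fj─Fk∣≡1))
    ... | suc d′ | d≡ = chain-≥ d′ i k dimFk≤dimFi dis≡d′ ∷ʳ (dimFj≤dimFk , dis[Fk,Fj]≡1)
      where
      dis≡d′ : dis (F O i) (F O k) ≡ + d′
      dis≡d′ = trans (dis≡∣─∣ (F O i) (F O k) dimFk≤dimFi) (cong +_ (sym (suc-injective d≡)))
      dis[Fk,Fj]≡1 : dis (F O k) (F O j) ≡ + 1
      dis[Fk,Fj]≡1 = trans (dis≡∣─∣ (F O k) (F O j) dimFj≤dimFk) (cong +_ ∣Fj─Fk∣≡1)

    chain-≥ : ∀ d i k → dim (F O k) ≤ dim (F O i) → dis (F O i) (F O k) ≡ + d → Chain i k d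
    chain-≥ d i k dimFk≤dimFi dis≡d with <-cmp i k
    ... | tri< i<k _ _ = chain d i k i<k dis≡d
    ... | tri≈ _ refl _ = subst (Chain i i) (+-injective (trans (sym (dis-self (F O i))) dis≡d)) []
    ... | tri> _ _ k<i =
      reverse (chain d k i k<i (trans (dis-sym (F O k) (F O i)) dis≡d)) dimFk≤dimFi

proposition3p17 : ∀ {n} (Δ : SimplicialComplex n) (O : FacetOrder Δ) →
    IsStrongShelling O → IsDimDecreasing O → IsQuasiHarmonious O →
    ∀ (i j : Fin (t O)) → i < j →
      Σ ℕ λ s → Σ (Fin (suc s) → Fin (t O)) λ G →
        G zero ≡ i
        × G (fromℕ s) ≡ j
        × (+ s ≡ dis (F O i) (F O j))
        × (∀ (h : Fin s) → dim (F O (G (fsuc h))) ≤ dim (F O (G (inject₁ h))))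
        × (∀ (h : Fin s) → dis (F O (G (inject₁ h))) (F O (G (fsuc h))) ≡ + 1)
proposition3p17 Δ O _ dimDecreasing quasiHarmonious i j i<j =
  ∣ F O j ─ F O i ∣ , vertex c , vertex-first c , vertex-last c , sym dis≡ ,
  proj₁ ∘ unitStep-at c , proj₂ ∘ unitStep-at c
  where
  open DescendingChain (F O)
  dis≡ : dis (F O i) (F O j) ≡ + ∣ F O j ─ F O i ∣
  dis≡ = dis≡∣─∣ (F O i) (F O j) (dimDecreasing i j i<j)
  c : Chain i j ∣ F O j ─ F O i ∣
  c = chain O dimDecreasing quasiHarmonious _ i j i<j dis≡
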